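{- Let $n$ be a positive integer and $m=\lceil\log_2 n\rceil$. The number of separating families of minimum size (namely of size $m$) for an $n$-element set is $$\frac{(n-1)!}{m!}\binom{2^{m}-1}{n-1}.$$
   Context: A bipartition of a set $S$ is a partition of $S$ into at most two nonempty components (so $\{S\}$ is a bipartition). A bipartition cuts two elements if they lie in different components. A family of bipartitions of $S$ is a separating family for $S$ if every two distinct elements of $S$ are cut by some bipartition in the family. -}

module Defs where

open import Data.Bool using (Bool; true; false)
open import Data.Nat using (ℕ; zero; suc; _∸_; _^_; _/_)
open import Data.Nat.Combinatorics using (_C_)
open import Data.Nat using (_!; _*_)
open import Data.Nat.Properties using (_!≢0)
open import Data.Nat.Logarithm using (⌈log₂_⌉)
open import Data.Fin using (Fin)
open import Data.Fin.Subset using (Subset; _∈_; _∉_)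
open import Data.Fin.Subset.Properties using (_∈?_)
open import Data.Fin.Properties using (all?)
open import Data.List using (List; []; _∷_; [_]; map; _++_; length; filter)
open import Data.List.Relation.Unary.Any using (Any; any?)
open import Data.Product using (_×_)
open import Data.Sum using (_⊎_)
open import Relation.Binary.PropositionalEquality using (_≡_)
open import Relation.Nullary using (¬_; Dec)
open import Relation.Nullary.Decidable using (_×-dec_; _⊎-dec_; _→-dec_; ¬?)
open import Data.Fin.Properties using (_≟_)
import Data.Nat.Properties as ℕP
import Data.Vec as Vec

allSubsets : (n : ℕ) → List (Subset n)
allSubsets zero = [ Vec.[] ]
allSubsets (suc n) = map (true Vec.∷_) (allSubsets n) ++ map (false Vec.∷_) (allSubsets n)

-- A bipartition {A , S ∖ A} of S = Fin (suc k) (into at most two nonempty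
-- components) is represented canonically by its component A containing the
-- element 0; the other component is the complement (empty iff the
-- bipartition is {S}).  This gives every bipartition exactly once.
bipartitions : (k : ℕ) → List (Subset (suc k))
bipartitions k = map (true Vec.∷_) (allSubsets k)

-- All sub-families (sublists) of a list; for a duplicate-free list these are
-- exactly its subsets, each listed once.
subfamilies : {A : Set} → List A → List (List A)
subfamilies [] = [ [] ]
subfamilies (x ∷ xs) = map (x ∷_) (subfamilies xs) ++ subfamilies xs

Cuts : {n : ℕ} → Subset n → Fin n → Fin n → Set
Cuts A x y = (x ∈ A × y ∉ A) ⊎ (x ∉ A × y ∈ A)

cuts? : {n : ℕ} (A : Subset n) (x y : Fin n) → Dec (Cuts A x y)
cuts? A x y = ((x ∈? A) ×-dec ¬? (y ∈? A)) ⊎-dec (¬? (x ∈? A) ×-dec (y ∈? A))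

Separating : {n : ℕ} → List (Subset n) → Set
Separating {n} F = (x y : Fin n) → ¬ (x ≡ y) → Any (λ A → Cuts A x y) F

separating? : {n : ℕ} (F : List (Subset n)) → Dec (Separating F)
separating? F = all? λ x → all? λ y → ¬? (x ≟ y) →-dec any? (λ A → cuts? A x y) F

numSeparatingFamilies : (k m : ℕ) → ℕ
numSeparatingFamilies k m =
  length (filter (λ F → (length F ℕP.≟ m) ×-dec separating? F) (subfamilies (bipartitions k)))

formula : (k m : ℕ) → ℕ
formula k m = (k ! / m !) * ((2 ^ m ∸ 1) C k)
  where
  instance _ = m !≢0

-- Order the members of a family of m bipartitions of {0, …, k} and give every point its code,
-- the word in {true, false}^m listing the side it lies on in each bipartition.  The sequence
-- separates iff the codes are pairwise distinct.  A bipartition is stored with 0 on its true side,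
-- so 0 has the all-true code and the other k points get distinct codes among the remaining 2^m - 1
-- words: there are (2^m - 1)(2^m - 2)⋯(2^m - k) = k! C(2^m - 1, k) separating sequences.
-- For m = ⌈log₂ (k + 1)⌉ this is sharp: k + 1 points need at least k + 1 codes, so a separating
-- family of at most m members has no repeated member, and every minimum separating family is
-- listed exactly m! times as a separating sequence.

module Submission where

open import Defs
open import Algebra.Properties.CommutativeSemigroup using (interchange)
open import Data.Bool using (Bool; true; false; if_then_else_)
import Data.Bool.Properties as Bool
open import Data.Empty using (⊥-elim)
open import Data.Fin using (Fin; zero; suc)
import Data.Fin.Properties as Fin
open import Data.Fin.Subset using (Subset)
open import Data.List
  using (List; []; _∷_; [_]; map; _++_; length; filter; cartesianProductWith; zipWith; replicate)
open import Data.List.Membership.Propositional using (_∈_; _∉_; find; lose)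
open import Data.List.Membership.Propositional.Properties
  using (∈-cartesianProductWith⁺; ∈-map⁺; ∈-++⁺ˡ; ∈-++⁺ʳ)
open import Data.List.Properties using (++-identityʳ; length-replicate; ≡-dec; ∷-injectiveˡ; ∷-injectiveʳ)
open import Data.List.Relation.Binary.Permutation.Propositional using (_↭_; prep; swap)
import Data.List.Relation.Binary.Permutation.Propositional as ↭
open import Data.List.Relation.Binary.Permutation.Propositional.Properties using (∈-resp-↭; ↭-length)
open import Data.List.Relation.Unary.All using (All; []; _∷_)
import Data.List.Relation.Unary.All as All
open import Data.List.Relation.Unary.All.Properties using (¬Any⇒All¬)
open import Data.List.Relation.Unary.AllPairs using ([]; _∷_)
open import Data.List.Relation.Unary.Any using (Any; here; there)
open import Data.List.Relation.Unary.Unique.Propositional using (Unique)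
open import Data.List.Relation.Unary.Unique.Propositional.Properties using (Unique[x∷xs]⇒x∉xs)
open import Data.Nat
  using (ℕ; zero; suc; pred; _+_; _*_; _∸_; _^_; _≤_; _<_; z≤n; s≤s; _!; _/_; _≤ᵇ_; ⌈_/2⌉)
open import Data.Nat.Combinatorics using (_C_; _P_; nCk≡nPk/k!)
open import Data.Nat.Combinatorics.Base using (_P′_)
open import Data.Nat.Combinatorics.Specification using (k!∣nP′k; nP′k≡n[n∸1P′k∸1])
open import Data.Nat.DivMod using (m*[n/m]≡n)
open import Data.Nat.Divisibility using (m≤n⇒m!∣n!)
open import Data.Nat.Induction using (<-wellFounded)
open import Data.Nat.Logarithm using (⌈log₂_⌉; ⌈log₂⌉-mono-≤; ⌈log₂2^n⌉≡n)
open import Data.Nat.Logarithm.Core using (⌈log2⌉)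
open import Data.Nat.Properties
open import Data.Product using (_×_; _,_; proj₁; proj₂)
open import Data.Sum using (inj₁; inj₂)
import Data.Vec as Vec
open import Data.Vec.Properties using ([]=⇒lookup; lookup⇒[]=)
open import Function using (_∘_; _⇔_; mk⇔; Equivalence)
open import Induction.WellFounded using (Acc; acc)
open import Relation.Binary.PropositionalEquality
  using (_≡_; _≢_; refl; sym; trans; cong; cong₂; subst; module ≡-Reasoning)
open import Relation.Nullary using (Dec; yes; no; does; ¬_)
open import Relation.Nullary.Decidable using (dec-true; dec-false; does-⇔; _×-dec_; _→-dec_)
open import Relation.Unary using (Decidable)

private
  variable
    A B Z : Set

∑ : List A → (A → ℕ) → ℕ
∑ []       f = 0
∑ (x ∷ xs) f = f x + ∑ xs f

∑-++ : ∀ xs ys (f : A → ℕ) → ∑ (xs ++ ys) f ≡ ∑ xs f + ∑ ys f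
∑-++ []       ys f = refl
∑-++ (x ∷ xs) ys f = trans (cong (f x +_) (∑-++ xs ys f)) (sym (+-assoc (f x) _ _))

∑-cong : ∀ xs {f g : A → ℕ} → (∀ x → f x ≡ g x) → ∑ xs f ≡ ∑ xs g
∑-cong []       f≗g = refl
∑-cong (x ∷ xs) f≗g = cong₂ _+_ (f≗g x) (∑-cong xs f≗g)

∑-zero : ∀ xs {f : A → ℕ} → (∀ x → f x ≡ 0) → ∑ xs f ≡ 0
∑-zero []       f≗0 = refl
∑-zero (x ∷ xs) f≗0 = cong₂ _+_ (f≗0 x) (∑-zero xs f≗0)

∑-+ : ∀ xs (f g : A → ℕ) → ∑ xs (λ x → f x + g x) ≡ ∑ xs f + ∑ xs g
∑-+ []       f g = refl
∑-+ (x ∷ xs) f g =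
  trans (cong (f x + g x +_) (∑-+ xs f g))
        (interchange +-commutativeSemigroup (f x) (g x) (∑ xs f) (∑ xs g))

∑-*ˡ : ∀ xs a (f : A → ℕ) → ∑ xs (λ x → a * f x) ≡ a * ∑ xs f
∑-*ˡ []       a f = sym (*-zeroʳ a)
∑-*ˡ (x ∷ xs) a f = trans (cong (a * f x +_) (∑-*ˡ xs a f)) (sym (*-distribˡ-+ a (f x) _))

∑-*ʳ : ∀ xs a (f : A → ℕ) → ∑ xs (λ x → f x * a) ≡ ∑ xs f * a
∑-*ʳ []       a f = refl
∑-*ʳ (x ∷ xs) a f = trans (cong (f x * a +_) (∑-*ʳ xs a f)) (sym (*-distribʳ-+ a (f x) _))

∈⇒≤∑ : ∀ {x xs} (f : A → ℕ) → x ∈ xs → f x ≤ ∑ xs f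
∈⇒≤∑ f (here refl) = m≤m+n _ _
∈⇒≤∑ f (there x∈xs) = ≤-trans (∈⇒≤∑ f x∈xs) (m≤n+m _ _)

∑-map : ∀ (g : A → B) xs (f : B → ℕ) → ∑ (map g xs) f ≡ ∑ xs (f ∘ g)
∑-map g []       f = refl
∑-map g (x ∷ xs) f = cong (f (g x) +_) (∑-map g xs f)

∑-comm : ∀ (xs : List A) (ys : List B) (f : A → B → ℕ) →
  ∑ xs (λ x → ∑ ys (f x)) ≡ ∑ ys (λ y → ∑ xs (λ x → f x y))
∑-comm []       ys f = sym (∑-zero ys (λ _ → refl))
∑-comm (x ∷ xs) ys f =
  trans (cong (∑ ys (f x) +_) (∑-comm xs ys f)) (sym (∑-+ ys (f x) (λ y → ∑ xs (λ x → f x y))))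

∑-cartesianProductWith : ∀ (g : A → B → Z) xs ys (f : Z → ℕ) →
  ∑ (cartesianProductWith g xs ys) f ≡ ∑ xs (λ x → ∑ ys (λ y → f (g x y)))
∑-cartesianProductWith g []       ys f = refl
∑-cartesianProductWith g (x ∷ xs) ys f = begin
  ∑ (map (g x) ys ++ cartesianProductWith g xs ys) f
    ≡⟨ ∑-++ (map (g x) ys) _ f ⟩
  ∑ (map (g x) ys) f + ∑ (cartesianProductWith g xs ys) f
    ≡⟨ cong₂ _+_ (∑-map (g x) ys f) (∑-cartesianProductWith g xs ys f) ⟩
  ∑ ys (f ∘ g x) + ∑ xs (λ x → ∑ ys (λ y → f (g x y)))
    ∎
  where open ≡-Reasoning

∑-const : ∀ (xs : List A) c → ∑ xs (λ _ → c) ≡ length xs * c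
∑-const []       c = refl
∑-const (x ∷ xs) c = cong (c +_) (∑-const xs c)

𝟙[_] : {P : Set} → Dec P → ℕ
𝟙[ P? ] = if does P? then 1 else 0

𝟙-⇔ : {P Q : Set} → P ⇔ Q → (P? : Dec P) (Q? : Dec Q) → 𝟙[ P? ] ≡ 𝟙[ Q? ]
𝟙-⇔ P⇔Q P? Q? = cong (λ b → if b then 1 else 0) (does-⇔ P⇔Q P? Q?)

𝟙-yes : {P : Set} (P? : Dec P) → P → 𝟙[ P? ] ≡ 1
𝟙-yes P? p = cong (λ b → if b then 1 else 0) (dec-true P? p)

𝟙-no : {P : Set} (P? : Dec P) → ¬ P → 𝟙[ P? ] ≡ 0
𝟙-no P? ¬p = cong (λ b → if b then 1 else 0) (dec-false P? ¬p)

count : {P : A → Set} → Decidable P → List A → ℕ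
count P? xs = ∑ xs (λ x → 𝟙[ P? x ])

length-filter : {P : A → Set} (P? : Decidable P) (xs : List A) →
  length (filter P? xs) ≡ count P? xs
length-filter P? []       = refl
length-filter P? (x ∷ xs) with does (P? x)
... | true  = cong suc (length-filter P? xs)
... | false = length-filter P? xs

∈⇒count-pos : {P : A → Set} (P? : Decidable P) {x : A} {xs : List A} →
  x ∈ xs → P x → 0 < count P? xs
∈⇒count-pos P? {x} x∈xs px =
  ≤-trans (≤-reflexive (sym (𝟙-yes (P? x) px))) (∈⇒≤∑ (λ x → 𝟙[ P? x ]) x∈xs)

sequences : ℕ → List A → List (List A)
sequences zero    xs = [ [] ]
sequences (suc m) xs = cartesianProductWith _∷_ xs (sequences m xs)

∑-sequences-cong : ∀ m (xs : List A) {f g : List A → ℕ} →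
  (∀ s → length s ≡ m → f s ≡ g s) → ∑ (sequences m xs) f ≡ ∑ (sequences m xs) g
∑-sequences-cong zero    xs f≗g = cong (_+ 0) (f≗g [] refl)
∑-sequences-cong (suc m) xs {f} {g} f≗g = begin
  ∑ (sequences (suc m) xs) f
    ≡⟨ ∑-cartesianProductWith _∷_ xs _ f ⟩
  ∑ xs (λ x → ∑ (sequences m xs) (f ∘ (x ∷_)))
    ≡⟨ ∑-cong xs (λ x → ∑-sequences-cong m xs (λ s → f≗g (x ∷ s) ∘ cong suc)) ⟩
  ∑ xs (λ x → ∑ (sequences m xs) (g ∘ (x ∷_)))
    ≡⟨ ∑-cartesianProductWith _∷_ xs _ g ⟨
  ∑ (sequences (suc m) xs) g
    ∎
  where open ≡-Reasoning

∈-sequences : {xs s : List A} → All (_∈ xs) s → s ∈ sequences (length s) xs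
∈-sequences []            = here refl
∈-sequences (x∈xs ∷ s⊆xs) = ∈-cartesianProductWith⁺ _∷_ x∈xs (∈-sequences s⊆xs)

∑-sequences-1 : ∀ m (xs : List A) → ∑ (sequences m xs) (λ _ → 1) ≡ length xs ^ m
∑-sequences-1 zero    xs = refl
∑-sequences-1 (suc m) xs = begin
  ∑ (sequences (suc m) xs) (λ _ → 1)          ≡⟨ ∑-cartesianProductWith _∷_ xs _ _ ⟩
  ∑ xs (λ _ → ∑ (sequences m xs) (λ _ → 1))   ≡⟨ ∑-cong xs (λ _ → ∑-sequences-1 m xs) ⟩
  ∑ xs (λ _ → length xs ^ m)                  ≡⟨ ∑-const xs _ ⟩
  length xs * length xs ^ m                   ∎
  where open ≡-Reasoning

∑-sequences-cartesianProductWith : ∀ (g : A → B → Z) m xs ys (f : List Z → ℕ) →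
  ∑ (sequences m (cartesianProductWith g xs ys)) f
    ≡ ∑ (sequences m xs) (λ c → ∑ (sequences m ys) (λ s → f (zipWith g c s)))
∑-sequences-cartesianProductWith g zero    xs ys f = sym (+-identityʳ _)
∑-sequences-cartesianProductWith g (suc m) xs ys f = begin
  ∑ (sequences (suc m) zs) f
    ≡⟨ ∑-cartesianProductWith _∷_ zs _ f ⟩
  ∑ zs (λ z → ∑ (sequences m zs) (f ∘ (z ∷_)))
    ≡⟨ ∑-cartesianProductWith g xs ys _ ⟩
  ∑ xs (λ x → ∑ ys (λ y → ∑ (sequences m zs) (f ∘ (g x y ∷_))))
    ≡⟨ ∑-cong xs (λ x → ∑-cong ys (λ y → ∑-sequences-cartesianProductWith g m xs ys _)) ⟩
  ∑ xs (λ x → ∑ ys (λ y → ∑ (sequences m xs) (λ c → ∑ (sequences m ys) (λ s → f (zipWith g (x ∷ c) (y ∷ s))))))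
    ≡⟨ ∑-cong xs (λ x → ∑-comm ys (sequences m xs) _) ⟩
  ∑ xs (λ x → ∑ (sequences m xs) (λ c → ∑ ys (λ y → ∑ (sequences m ys) (λ s → f (zipWith g (x ∷ c) (y ∷ s))))))
    ≡⟨ ∑-cong xs (λ x → ∑-cong (sequences m xs) (λ c → ∑-cartesianProductWith _∷_ ys _ _)) ⟨
  ∑ xs (λ x → ∑ (sequences m xs) (λ c → ∑ (sequences (suc m) ys) (λ s → f (zipWith g (x ∷ c) s))))
    ≡⟨ ∑-cartesianProductWith _∷_ xs _ _ ⟨
  ∑ (sequences (suc m) xs) (λ c → ∑ (sequences (suc m) ys) (λ s → f (zipWith g c s)))
    ∎
  where
  open ≡-Reasoning
  zs = cartesianProductWith g xs ys

∑-sequences-singleton : ∀ m (x : A) (f : List A → ℕ) → ∑ (sequences m [ x ]) f ≡ f (replicate m x)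
∑-sequences-singleton zero    x f = +-identityʳ _
∑-sequences-singleton (suc m) x f =
  trans (∑-cartesianProductWith _∷_ [ x ] (sequences m [ x ]) f)
        (trans (+-identityʳ _) (∑-sequences-singleton m x (f ∘ (x ∷_))))

record IsSetPredicate (P : List A → Set) : Set where
  field
    resp-↭ : ∀ {xs ys} → xs ↭ ys → P xs → P ys
    head-∉ : ∀ {x xs} → P (x ∷ xs) → x ∉ xs

open IsSetPredicate

IsSetPredicate-∷ : ∀ {P : List A → Set} x → IsSetPredicate P → IsSetPredicate (P ∘ (x ∷_))
IsSetPredicate-∷ x isSet .resp-↭ xs↭ys = isSet .resp-↭ (prep x xs↭ys)
IsSetPredicate-∷ x isSet .head-∉ {y} Pxys y∈xs =
  isSet .head-∉ (isSet .resp-↭ (swap x y ↭.refl) Pxys) (there y∈xs)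

module _ {P : List A → Set} (P? : Decidable P) where

  sublistCount : ℕ → List A → ℕ
  sublistCount m xs = count (λ F → (length F ≟ m) ×-dec P? F) (subfamilies xs)

  prepend? : (x : A) → Decidable (P ∘ (x ∷_))
  prepend? x s = P? (x ∷ s)

sublistCount-∷-suc : ∀ {P : List A → Set} (P? : Decidable P) m x xs →
  sublistCount P? (suc m) (x ∷ xs) ≡ sublistCount (prepend? P? x) m xs + sublistCount P? (suc m) xs
sublistCount-∷-suc P? m x xs =
  trans (∑-++ (map (x ∷_) (subfamilies xs)) _ _) (cong (_+ _) (∑-map (x ∷_) (subfamilies xs) _))

sublistCount-zero : ∀ {P : List A → Set} (P? : Decidable P) xs → sublistCount P? zero xs ≡ 𝟙[ P? [] ]
sublistCount-zero P? []       = +-identityʳ _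
sublistCount-zero P? (x ∷ xs) = begin
  sublistCount P? zero (x ∷ xs)
    ≡⟨ ∑-++ (map (x ∷_) (subfamilies xs)) _ _ ⟩
  ∑ (map (x ∷_) (subfamilies xs)) _ + sublistCount P? zero xs
    ≡⟨ cong (_+ _) (trans (∑-map (x ∷_) (subfamilies xs) _) (∑-zero (subfamilies xs) (λ _ → refl))) ⟩
  sublistCount P? zero xs
    ≡⟨ sublistCount-zero P? xs ⟩
  𝟙[ P? [] ]
    ∎
  where open ≡-Reasoning

sublistCount-one : ∀ {P : List A → Set} (P? : Decidable P) xs →
  sublistCount P? 1 xs ≡ ∑ xs (λ x → 𝟙[ P? [ x ] ])
sublistCount-one P? []       = refl
sublistCount-one P? (x ∷ xs) =
  trans (sublistCount-∷-suc P? 0 x xs)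
        (cong₂ _+_ (sublistCount-zero (prepend? P? x) xs) (sublistCount-one P? xs))

sublistCount-none : ∀ {P : List A → Set} (P? : Decidable P) m xs →
  (∀ F → ¬ P F) → sublistCount P? m xs ≡ 0
sublistCount-none P? m xs ¬P =
  ∑-zero (subfamilies xs) (λ F → 𝟙-no ((length F ≟ m) ×-dec P? F) (¬P F ∘ proj₂))

sublistCount-cong : ∀ {P Q : List A → Set} (P? : Decidable P) (Q? : Decidable Q) m xs →
  (∀ F → length F ≡ m → P F ⇔ Q F) → sublistCount P? m xs ≡ sublistCount Q? m xs
sublistCount-cong P? Q? m xs P⇔Q = ∑-cong (subfamilies xs) λ F →
  𝟙-⇔ (mk⇔ (λ (eq , p) → eq , Equivalence.to (P⇔Q F eq) p)
           (λ (eq , q) → eq , Equivalence.from (P⇔Q F eq) q))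
      ((length F ≟ m) ×-dec P? F) ((length F ≟ m) ×-dec Q? F)

-- Double counting pairs of an (m+1)-element sublist and one of its members, moved to the front.
∑-sublistCount-prepend : ∀ {P : List A → Set} (P? : Decidable P) → IsSetPredicate P → ∀ m xs →
  ∑ xs (λ y → sublistCount (prepend? P? y) m xs) ≡ suc m * sublistCount P? (suc m) xs
∑-sublistCount-prepend P? isSet zero xs = begin
  ∑ xs (λ y → sublistCount (prepend? P? y) 0 xs)
    ≡⟨ ∑-cong xs (λ y → sublistCount-zero (prepend? P? y) xs) ⟩
  ∑ xs (λ y → 𝟙[ P? [ y ] ])
    ≡⟨ sublistCount-one P? xs ⟨
  sublistCount P? 1 xs
    ≡⟨ *-identityˡ _ ⟨
  1 * sublistCount P? 1 xs
    ∎
  where open ≡-Reasoning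
∑-sublistCount-prepend P? isSet (suc m) []       = sym (*-zeroʳ (suc (suc m)))
∑-sublistCount-prepend {A = A} {P = P} P? isSet (suc m) (x ∷ xs) = begin
  sublistCount Px (suc m) (x ∷ xs) + ∑ xs (λ y → sublistCount (prepend? P? y) (suc m) (x ∷ xs))
    ≡⟨ cong₂ _+_ (sublistCount-∷-suc Px m x xs)
                 (∑-cong xs (λ y → sublistCount-∷-suc (prepend? P? y) m x xs)) ⟩
  (sublistCount (prepend? Px x) m xs + a) + ∑ xs (λ y → startYX y + startY y)
    ≡⟨ cong₂ _+_ (cong (_+ a) startXX≡0) (∑-+ xs startYX startY) ⟩
  a + (∑ xs startYX + ∑ xs startY)
    ≡⟨ cong (λ t → a + (t + ∑ xs startY)) (∑-cong xs startYX≡startXY) ⟩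
  a + (∑ xs startXY + ∑ xs startY)
    ≡⟨ cong₂ (λ s t → a + (s + t)) (∑-sublistCount-prepend Px (IsSetPredicate-∷ x isSet) m xs)
                                   (∑-sublistCount-prepend P? isSet (suc m) xs) ⟩
  a + (suc m * a + suc (suc m) * b)
    ≡⟨ +-assoc a (suc m * a) _ ⟨
  suc (suc m) * a + suc (suc m) * b
    ≡⟨ *-distribˡ-+ (suc (suc m)) a b ⟨
  suc (suc m) * (a + b)
    ≡⟨ cong (suc (suc m) *_) (sublistCount-∷-suc P? (suc m) x xs) ⟨
  suc (suc m) * sublistCount P? (suc (suc m)) (x ∷ xs)
    ∎
  where
  open ≡-Reasoning
  Px = prepend? P? x
  a = sublistCount Px (suc m) xs
  b = sublistCount P? (suc (suc m)) xs
  startY startYX startXY : A → ℕ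
  startY  y = sublistCount (prepend? P? y) (suc m) xs
  startYX y = sublistCount (prepend? (prepend? P? y) x) m xs
  startXY y = sublistCount (prepend? Px y) m xs
  startXX≡0 : sublistCount (prepend? Px x) m xs ≡ 0
  startXX≡0 = sublistCount-none (prepend? Px x) m xs (λ F Pxx → isSet .head-∉ Pxx (here refl))
  startYX≡startXY : ∀ y → startYX y ≡ startXY y
  startYX≡startXY y = sublistCount-cong (prepend? (prepend? P? y) x) (prepend? Px y) m xs
    (λ F _ → mk⇔ (isSet .resp-↭ (swap y x ↭.refl)) (isSet .resp-↭ (swap x y ↭.refl)))

factorial-sublistCount : ∀ {P : List A → Set} (P? : Decidable P) → IsSetPredicate P → ∀ m xs →
  m ! * sublistCount P? m xs ≡ count P? (sequences m xs)
factorial-sublistCount P? isSet zero    xs = cong (_+ 0) (sublistCount-zero P? xs)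
factorial-sublistCount P? isSet (suc m) xs = begin
  (suc m * m !) * sublistCount P? (suc m) xs
    ≡⟨ cong (_* sublistCount P? (suc m) xs) (*-comm (suc m) (m !)) ⟩
  (m ! * suc m) * sublistCount P? (suc m) xs
    ≡⟨ *-assoc (m !) (suc m) _ ⟩
  m ! * (suc m * sublistCount P? (suc m) xs)
    ≡⟨ cong (m ! *_) (∑-sublistCount-prepend P? isSet m xs) ⟨
  m ! * ∑ xs (λ y → sublistCount (prepend? P? y) m xs)
    ≡⟨ ∑-*ˡ xs (m !) _ ⟨
  ∑ xs (λ y → m ! * sublistCount (prepend? P? y) m xs)
    ≡⟨ ∑-cong xs (λ y → factorial-sublistCount (prepend? P? y) (IsSetPredicate-∷ y isSet) m xs) ⟩
  ∑ xs (λ y → count (prepend? P? y) (sequences m xs))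
    ≡⟨ ∑-cartesianProductWith _∷_ xs (sequences m xs) _ ⟨
  count P? (sequences (suc m) xs)
    ∎
  where open ≡-Reasoning

P′-suc : ∀ n k → n P′ suc k ≡ n * (pred n P′ k)
P′-suc zero    k = cong (_* (0 P′ k)) (0∸n≡0 k)
P′-suc (suc n) k = nP′k≡n[n∸1P′k∸1] (suc n) (suc k)

P′-vanishes : ∀ {n k} → n < k → n P′ k ≡ 0
P′-vanishes {n} {suc k} (s≤s n≤k) = cong (_* (n P′ k)) (m≤n⇒m∸n≡0 n≤k)

P′≡!*C : ∀ {n k} → k ≤ n → n P′ k ≡ k ! * (n C k)
P′≡!*C {n} {k} k≤n = begin
  n P′ k                      ≡⟨ m*[n/m]≡n (k!∣nP′k k≤n) ⟨
  k ! * ((n P′ k) / k !)      ≡⟨ cong (λ p → k ! * (p / k !)) P≡P′ ⟨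
  k ! * ((n P k) / k !)       ≡⟨ cong (k ! *_) (nCk≡nPk/k! k≤n) ⟨
  k ! * (n C k)               ∎
  where
  open ≡-Reasoning
  instance _ = k !≢0
  P≡P′ : n P k ≡ n P′ k
  P≡P′ with k ≤ᵇ n | ≤⇒≤ᵇ k≤n
  ... | true | _ = refl

Code : Set
Code = List Bool

_≟ᶜ_ : (c d : Code) → Dec (c ≡ d)
_≟ᶜ_ = ≡-dec Bool._≟_

open import Data.List.Membership.DecPropositional _≟ᶜ_ using (_∉?_)

module _ {n : ℕ} where

  code : List (Subset n) → Fin n → Code
  code F x = map (λ S → Vec.lookup S x) F

  Cuts⇔lookup≢ : ∀ (S : Subset n) x y → Cuts S x y ⇔ (Vec.lookup S x ≢ Vec.lookup S y)
  Cuts⇔lookup≢ S x y = mk⇔ to from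
    where
    to : Cuts S x y → Vec.lookup S x ≢ Vec.lookup S y
    to (inj₁ (x∈S , y∉S)) eq = y∉S (lookup⇒[]= y S (trans (sym eq) ([]=⇒lookup x∈S)))
    to (inj₂ (x∉S , y∈S)) eq = x∉S (lookup⇒[]= x S (trans eq ([]=⇒lookup y∈S)))
    from : Vec.lookup S x ≢ Vec.lookup S y → Cuts S x y
    from neq with Vec.lookup S x in x-side | Vec.lookup S y in y-side
    ... | true  | true  = ⊥-elim (neq refl)
    ... | false | false = ⊥-elim (neq refl)
    ... | true  | false = inj₁ (lookup⇒[]= x S x-side , λ y∈S → neq (trans (sym ([]=⇒lookup y∈S)) y-side))
    ... | false | true  = inj₂ ((λ x∈S → neq (trans (sym x-side) ([]=⇒lookup x∈S))) , lookup⇒[]= y S y-side)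

  cuts⇔code≢ : ∀ F x y → Any (λ S → Cuts S x y) F ⇔ (code F x ≢ code F y)
  cuts⇔code≢ F x y = mk⇔ (to F) (from F)
    where
    to : ∀ F → Any (λ S → Cuts S x y) F → code F x ≢ code F y
    to (S ∷ F) (here cut)  eq = Equivalence.to (Cuts⇔lookup≢ S x y) cut (∷-injectiveˡ eq)
    to (S ∷ F) (there cut) eq = to F cut (∷-injectiveʳ eq)
    from : ∀ F → code F x ≢ code F y → Any (λ S → Cuts S x y) F
    from []      neq = ⊥-elim (neq refl)
    from (S ∷ F) neq with Vec.lookup S x Bool.≟ Vec.lookup S y
    ... | yes same = there (from F (neq ∘ cong₂ _∷_ same))
    ... | no differ = here (Equivalence.from (Cuts⇔lookup≢ S x y) differ)

  DistinctCodes : List Code → List (Subset n) → Set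
  DistinctCodes D F = (∀ x y → code F x ≡ code F y → x ≡ y) × (∀ x → code F x ∉ D)

  distinctCodes? : ∀ D F → Dec (DistinctCodes D F)
  distinctCodes? D F =
    (Fin.all? λ x → Fin.all? λ y → (code F x ≟ᶜ code F y) →-dec (x Fin.≟ y))
      ×-dec Fin.all? (λ x → code F x ∉? D)

  Separating⇔DistinctCodes : ∀ F → Separating F ⇔ DistinctCodes [] F
  Separating⇔DistinctCodes F = mk⇔ to from
    where
    to : Separating F → DistinctCodes [] F
    to sep = injective , λ x ()
      where
      injective : ∀ x y → code F x ≡ code F y → x ≡ y
      injective x y eq with x Fin.≟ y
      ... | yes x≡y = x≡y
      ... | no x≢y  = ⊥-elim (Equivalence.to (cuts⇔code≢ F x y) (sep x y x≢y) eq)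
    from : DistinctCodes [] F → Separating F
    from (injective , _) x y x≢y = Equivalence.from (cuts⇔code≢ F x y) (x≢y ∘ injective x y)

module _ {n : ℕ} where

  code-zipWith-zero : ∀ (c : Code) (F : List (Subset n)) → length c ≡ length F →
    code (zipWith Vec._∷_ c F) zero ≡ c
  code-zipWith-zero []      []      _  = refl
  code-zipWith-zero (b ∷ c) (S ∷ F) eq = cong (b ∷_) (code-zipWith-zero c F (suc-injective eq))

  code-zipWith-suc : ∀ (c : Code) (F : List (Subset n)) → length c ≡ length F →
    ∀ x → code (zipWith Vec._∷_ c F) (suc x) ≡ code F x
  code-zipWith-suc []      []      _  x = refl
  code-zipWith-suc (b ∷ c) (S ∷ F) eq x = cong (_ ∷_) (code-zipWith-suc c F (suc-injective eq) x)

  -- zipWith Vec._∷_ c F adds a new point 0 with code c to the family F.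
  DistinctCodes-zipWith : ∀ D (c : Code) (F : List (Subset n)) → length c ≡ length F →
    DistinctCodes D (zipWith Vec._∷_ c F) ⇔ (c ∉ D × DistinctCodes (c ∷ D) F)
  DistinctCodes-zipWith D c F eq = mk⇔ to from
    where
    G = zipWith Vec._∷_ c F
    code₀ : code G zero ≡ c
    code₀ = code-zipWith-zero c F eq
    codeₛ : ∀ x → code G (suc x) ≡ code F x
    codeₛ = code-zipWith-suc c F eq

    to : DistinctCodes D G → c ∉ D × DistinctCodes (c ∷ D) F
    to (injective , fresh) = fresh zero ∘ subst (_∈ D) (sym code₀) , injective′ , fresh′
      where
      injective′ : ∀ x y → code F x ≡ code F y → x ≡ y
      injective′ x y same =
        Fin.suc-injective (injective (suc x) (suc y) (trans (codeₛ x) (trans same (sym (codeₛ y)))))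
      fresh′ : ∀ x → code F x ∉ c ∷ D
      fresh′ x (here same) with injective (suc x) zero (trans (codeₛ x) (trans same (sym code₀)))
      ... | ()
      fresh′ x (there x∈D) = fresh (suc x) (subst (_∈ D) (sym (codeₛ x)) x∈D)

    from : c ∉ D × DistinctCodes (c ∷ D) F → DistinctCodes D G
    from (c∉D , injective , fresh) = injective′ , fresh′
      where
      injective′ : ∀ x y → code G x ≡ code G y → x ≡ y
      injective′ zero    zero    _    = refl
      injective′ zero    (suc y) same =
        ⊥-elim (fresh y (here (trans (sym (codeₛ y)) (trans (sym same) code₀))))
      injective′ (suc x) zero    same =
        ⊥-elim (fresh x (here (trans (sym (codeₛ x)) (trans same code₀))))
      injective′ (suc x) (suc y) same =
        cong suc (injective x y (trans (sym (codeₛ x)) (trans same (codeₛ y))))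
      fresh′ : ∀ x → code G x ∉ D
      fresh′ zero    = c∉D ∘ subst (_∈ D) code₀
      fresh′ (suc x) = fresh x ∘ there ∘ subst (_∈ D) (codeₛ x)

bools : List Bool
bools = true ∷ false ∷ []

allSubsets-suc : ∀ n → allSubsets (suc n) ≡ cartesianProductWith Vec._∷_ bools (allSubsets n)
allSubsets-suc n = cong (map (true Vec.∷_) (allSubsets n) ++_) (sym (++-identityʳ _))

∈-allSubsets : ∀ {n} (S : Subset n) → S ∈ allSubsets n
∈-allSubsets Vec.[]          = here refl
∈-allSubsets (true Vec.∷ S)  = ∈-++⁺ˡ (∈-map⁺ (true Vec.∷_) (∈-allSubsets S))
∈-allSubsets (false Vec.∷ S) = ∈-++⁺ʳ _ (∈-map⁺ (false Vec.∷_) (∈-allSubsets S))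

count-≡ : ∀ d → count (_≟ᶜ d) (sequences (length d) bools) ≡ 1
count-≡ []          = refl
count-≡ (true ∷ d)  =
  trans (∑-cartesianProductWith _∷_ bools (sequences (length d) bools) _)
        (cong₂ _+_ (count-≡ d) (cong (_+ 0) (∑-zero (sequences (length d) bools) (λ _ → refl))))
count-≡ (false ∷ d) =
  trans (∑-cartesianProductWith _∷_ bools (sequences (length d) bools) _)
        (cong₂ _+_ (∑-zero (sequences (length d) bools) (λ _ → refl)) (trans (+-identityʳ _) (count-≡ d)))

-- c ∉? d ∷ D first tests c ≟ᶜ d, so both sides compute once that test is decided.
𝟙-∉-∷ : ∀ {c d : Code} {D} → d ∉ D → 𝟙[ c ∉? D ] ≡ 𝟙[ c ∉? d ∷ D ] + 𝟙[ c ≟ᶜ d ]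
𝟙-∉-∷ {c} {d} {D} d∉D with c ≟ᶜ d
... | yes refl = 𝟙-yes (c ∉? D) d∉D
... | no _     = sym (+-identityʳ _)

count-∉ : ∀ m D → Unique D → All (λ d → length d ≡ m) D →
  count (_∉? D) (sequences m bools) + length D ≡ 2 ^ m
count-∉ m []      _          _               = trans (+-identityʳ _) (∑-sequences-1 m bools)
count-∉ m (d ∷ D) uniq@(_ ∷ uniqD) (refl ∷ lengths) = begin
  count (_∉? d ∷ D) Cs + suc (length D)
    ≡⟨ +-assoc _ 1 (length D) ⟨
  (count (_∉? d ∷ D) Cs + 1) + length D
    ≡⟨ cong (λ t → (count (_∉? d ∷ D) Cs + t) + length D) (count-≡ d) ⟨
  (count (_∉? d ∷ D) Cs + count (_≟ᶜ d) Cs) + length D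
    ≡⟨ cong (_+ length D) (∑-+ Cs _ _) ⟨
  ∑ Cs (λ c → 𝟙[ c ∉? d ∷ D ] + 𝟙[ c ≟ᶜ d ]) + length D
    ≡⟨ cong (_+ length D) (∑-cong Cs (λ c → 𝟙-∉-∷ d∉D)) ⟨
  count (_∉? D) Cs + length D
    ≡⟨ count-∉ (length d) D uniqD lengths ⟩
  2 ^ length d
    ∎
  where
  open ≡-Reasoning
  Cs = sequences (length d) bools
  d∉D : d ∉ D
  d∉D = Unique[x∷xs]⇒x∉xs uniq

count-distinctCodes : ∀ m n D → Unique D → All (λ d → length d ≡ m) D →
  count (distinctCodes? D) (sequences m (allSubsets n)) ≡ (2 ^ m ∸ length D) P′ n
count-distinctCodes m zero    D _    _       =
  trans (∑-cong (sequences m _) (λ F → 𝟙-yes (distinctCodes? D F) ((λ ()) , (λ ()))))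
        (trans (∑-sequences-1 m _) (^-zeroˡ m))
count-distinctCodes m (suc n) D uniq lengths = begin
  count (distinctCodes? D) (sequences m (allSubsets (suc n)))
    ≡⟨ cong (λ Ss → count (distinctCodes? D) (sequences m Ss)) (allSubsets-suc n) ⟩
  count (distinctCodes? D) (sequences m (cartesianProductWith Vec._∷_ bools (allSubsets n)))
    ≡⟨ ∑-sequences-cartesianProductWith Vec._∷_ m bools (allSubsets n) _ ⟩
  ∑ Cs (λ c → ∑ Fs (λ F → 𝟙[ distinctCodes? D (zipWith Vec._∷_ c F) ]))
    ≡⟨ ∑-sequences-cong m bools (λ c → extend c) ⟩
  ∑ Cs (λ c → 𝟙[ c ∉? D ] * rest)
    ≡⟨ ∑-*ʳ Cs rest _ ⟩
  count (_∉? D) Cs * rest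
    ≡⟨ cong (_* rest) (trans (sym (m+n∸n≡m _ (length D)))
                             (cong (_∸ length D) (count-∉ m D uniq lengths))) ⟩
  (2 ^ m ∸ length D) * rest
    ≡⟨ cong ((2 ^ m ∸ length D) *_) (cong (_P′ n) (pred[m∸n]≡m∸[1+n] (2 ^ m) (length D))) ⟨
  (2 ^ m ∸ length D) * (pred (2 ^ m ∸ length D) P′ n)
    ≡⟨ P′-suc (2 ^ m ∸ length D) n ⟨
  (2 ^ m ∸ length D) P′ suc n
    ∎
  where
  open ≡-Reasoning
  Cs = sequences m bools
  Fs = sequences m (allSubsets n)
  rest = (2 ^ m ∸ suc (length D)) P′ n
  extend : ∀ c → length c ≡ m →
    ∑ Fs (λ F → 𝟙[ distinctCodes? D (zipWith Vec._∷_ c F) ]) ≡ 𝟙[ c ∉? D ] * rest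
  extend c lc = trans (∑-sequences-cong m (allSubsets n) zipped) (fresh? (c ∉? D))
    where
    zipped : ∀ F → length F ≡ m →
      𝟙[ distinctCodes? D (zipWith Vec._∷_ c F) ] ≡ 𝟙[ (c ∉? D) ×-dec distinctCodes? (c ∷ D) F ]
    zipped F lF = 𝟙-⇔ (DistinctCodes-zipWith D c F (trans lc (sym lF)))
      (distinctCodes? D (zipWith Vec._∷_ c F)) ((c ∉? D) ×-dec distinctCodes? (c ∷ D) F)
    fresh? : (c∉?D : Dec (c ∉ D)) →
      ∑ Fs (λ F → 𝟙[ c∉?D ×-dec distinctCodes? (c ∷ D) F ]) ≡ 𝟙[ c∉?D ] * rest
    fresh? (yes c∉D) = trans (count-distinctCodes m n (c ∷ D) (¬Any⇒All¬ D c∉D ∷ uniq) (lc ∷ lengths))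
                             (sym (+-identityʳ rest))
    fresh? (no _)    = ∑-zero Fs (λ _ → refl)

count-separating : ∀ m n → count separating? (sequences m (allSubsets n)) ≡ 2 ^ m P′ n
count-separating m n =
  trans (∑-cong (sequences m (allSubsets n))
                (λ F → 𝟙-⇔ (Separating⇔DistinctCodes F) (separating? F) (distinctCodes? [] F)))
        (count-distinctCodes m n [] [] [])

-- Every bipartition has 0 on its true side, so 0 has the all-true code and all other codes avoid it.
count-separating-bipartitions : ∀ m k →
  count separating? (sequences m (bipartitions k)) ≡ (2 ^ m ∸ 1) P′ k
count-separating-bipartitions m k = begin
  count separating? (sequences m (bipartitions k))
    ≡⟨ cong (λ Bs → count separating? (sequences m Bs)) (sym (++-identityʳ _)) ⟩
  count separating? (sequences m (cartesianProductWith Vec._∷_ [ true ] (allSubsets k)))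
    ≡⟨ ∑-sequences-cartesianProductWith Vec._∷_ m [ true ] (allSubsets k) _ ⟩
  ∑ (sequences m [ true ]) (λ c → ∑ Fs (λ F → 𝟙[ separating? (zipWith Vec._∷_ c F) ]))
    ≡⟨ ∑-sequences-singleton m true _ ⟩
  ∑ Fs (λ F → 𝟙[ separating? (zipWith Vec._∷_ r F) ])
    ≡⟨ ∑-sequences-cong m (allSubsets k) (λ F lF →
         𝟙-⇔ (separating⇔ F lF) (separating? (zipWith Vec._∷_ r F)) (distinctCodes? [ r ] F)) ⟩
  count (distinctCodes? [ r ]) Fs
    ≡⟨ count-distinctCodes m k [ r ] ([] ∷ []) (length-replicate m ∷ []) ⟩
  (2 ^ m ∸ 1) P′ k
    ∎
  where
  open ≡-Reasoning
  Fs = sequences m (allSubsets k)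
  r = replicate m true
  separating⇔ : ∀ F → length F ≡ m → Separating (zipWith Vec._∷_ r F) ⇔ DistinctCodes [ r ] F
  separating⇔ F lF = mk⇔ (proj₂ ∘ to split ∘ to (Separating⇔DistinctCodes _))
                         (from (Separating⇔DistinctCodes _) ∘ from split ∘ ((λ ()) ,_))
    where
    open Equivalence
    split : DistinctCodes [] (zipWith Vec._∷_ r F) ⇔ (r ∉ [] × DistinctCodes [ r ] F)
    split = DistinctCodes-zipWith [] r F (trans (length-replicate m) (sym lF))

2^<n : ∀ {j n} → j < ⌈log₂ n ⌉ → 2 ^ j < n
2^<n {j} j<⌈log₂n⌉ = ≰⇒> λ n≤2^j →
  <⇒≱ j<⌈log₂n⌉ (≤-trans (⌈log₂⌉-mono-≤ n≤2^j) (≤-reflexive (⌈log₂2^n⌉≡n j)))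

module _ {n : ℕ} where

  Separating-⊆ : {F G : List (Subset n)} → (∀ {S} → S ∈ F → S ∈ G) → Separating F → Separating G
  Separating-⊆ F⊆G sep x y x≢y with find (sep x y x≢y)
  ... | S , S∈F , cut = lose (F⊆G S∈F) cut

  separating⇒≤2^length : (F : List (Subset n)) → Separating F → n ≤ 2 ^ length F
  separating⇒≤2^length F sep =
    ≮⇒≥ λ 2^|F|<n → n≮n 0 (subst (0 <_) (no-separating 2^|F|<n) witness)
    where
    witness : 0 < count separating? (sequences (length F) (allSubsets n))
    witness = ∈⇒count-pos separating? (∈-sequences (All.tabulate (λ {S} _ → ∈-allSubsets S))) sep
    no-separating : 2 ^ length F < n → count separating? (sequences (length F) (allSubsets n)) ≡ 0
    no-separating 2^|F|<n = trans (count-separating (length F) n) (P′-vanishes 2^|F|<n)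

  OptimallySeparating : List (Subset n) → Set
  OptimallySeparating F = Separating F × length F ≤ ⌈log₂ n ⌉

  optimallySeparating? : Decidable OptimallySeparating
  optimallySeparating? F = separating? F ×-dec (length F ≤? ⌈log₂ n ⌉)

  -- A separating family of at most ⌈log₂ n⌉ members cannot repeat a member: dropping the copy
  -- would leave a separating family below the bound 2 ^ length F ≥ n.
  optimallySeparating-isSetPredicate : IsSetPredicate OptimallySeparating
  optimallySeparating-isSetPredicate .resp-↭ F↭G (sep , short) =
    Separating-⊆ (∈-resp-↭ F↭G) sep , subst (_≤ ⌈log₂ n ⌉) (↭-length F↭G) short
  optimallySeparating-isSetPredicate .head-∉ {S} {F} (sep , short) S∈F =
    <⇒≱ (2^<n short) (separating⇒≤2^length F (Separating-⊆ drop-head sep))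
    where
    drop-head : ∀ {T} → T ∈ S ∷ F → T ∈ F
    drop-head (here refl) = S∈F
    drop-head (there T∈F) = T∈F

-- ⌈log₂ n ⌉ is ⌈log2⌉ n (<-wellFounded n), so we recurse along that accessibility proof.
n≤2^⌈log₂n⌉ : ∀ n → n ≤ 2 ^ ⌈log₂ n ⌉
n≤2^⌈log₂n⌉ n = bound n (<-wellFounded n)
  where
  bound : ∀ n (acc : Acc _<_ n) → n ≤ 2 ^ ⌈log2⌉ n acc
  bound 0             _        = z≤n
  bound 1             _        = ≤-refl
  bound (suc (suc n)) (acc rs) = begin
    2 + n                                         ≤⟨ +-monoʳ-≤ 2 n≤2⌈n/2⌉ ⟩
    2 + (⌈ n /2⌉ + ⌈ n /2⌉)                      ≡⟨ cong (λ t → 2 + (⌈ n /2⌉ + t)) (+-identityʳ ⌈ n /2⌉) ⟨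
    2 + 2 * ⌈ n /2⌉                               ≡⟨ *-suc 2 ⌈ n /2⌉ ⟨
    2 * suc ⌈ n /2⌉                               ≤⟨ *-monoʳ-≤ 2 (bound (suc ⌈ n /2⌉) (rs (⌈n/2⌉<n n))) ⟩
    2 * 2 ^ ⌈log2⌉ (suc ⌈ n /2⌉) (rs (⌈n/2⌉<n n)) ∎
    where
    open ≤-Reasoning
    n≤2⌈n/2⌉ : n ≤ ⌈ n /2⌉ + ⌈ n /2⌉
    n≤2⌈n/2⌉ = subst (_≤ ⌈ n /2⌉ + ⌈ n /2⌉) (⌊n/2⌋+⌈n/2⌉≡n n) (+-monoˡ-≤ ⌈ n /2⌉ (⌊n/2⌋≤⌈n/2⌉ n))

1+n≤2^n : ∀ n → suc n ≤ 2 ^ n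
1+n≤2^n zero    = ≤-refl
1+n≤2^n (suc n) = +-mono-≤ (m^n>0 2 n) (≤-trans (1+n≤2^n n) (m≤m+n _ 0))

⌈log₂1+n⌉≤n : ∀ n → ⌈log₂ suc n ⌉ ≤ n
⌈log₂1+n⌉≤n n = ≤-trans (⌈log₂⌉-mono-≤ (1+n≤2^n n)) (≤-reflexive (⌈log₂2^n⌉≡n n))

m!*x≡k!*y⇒x≡[k!/m!]*y : ∀ {m k} x y → m ≤ k → m ! * x ≡ k ! * y → x ≡ (k ! / m !) {{m !≢0}} * y
m!*x≡k!*y⇒x≡[k!/m!]*y {m} {k} x y m≤k eq = *-cancelˡ-≡ x _ (m !) (begin
  m ! * x                   ≡⟨ eq ⟩
  k ! * y                   ≡⟨ cong (_* y) (m*[n/m]≡n (m≤n⇒m!∣n! m≤k)) ⟨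
  (m ! * (k ! / m !)) * y   ≡⟨ *-assoc (m !) _ y ⟩
  m ! * ((k ! / m !) * y)   ∎)
  where
  open ≡-Reasoning
  instance _ = m !≢0

proposition3p9 : (k : ℕ) → numSeparatingFamilies k ⌈log₂ suc k ⌉ ≡ formula k ⌈log₂ suc k ⌉
proposition3p9 k = m!*x≡k!*y⇒x≡[k!/m!]*y _ _ (⌈log₂1+n⌉≤n k) (begin
  m ! * numSeparatingFamilies k m
    ≡⟨ cong (m ! *_) (length-filter _ (subfamilies Bs)) ⟩
  m ! * sublistCount separating? m Bs
    ≡⟨ cong (m ! *_) (sublistCount-cong separating? optimallySeparating? m Bs (λ F |F|≡m →
         mk⇔ (_, ≤-reflexive |F|≡m) proj₁)) ⟩
  m ! * sublistCount optimallySeparating? m Bs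
    ≡⟨ factorial-sublistCount optimallySeparating? optimallySeparating-isSetPredicate m Bs ⟩
  count optimallySeparating? (sequences m Bs)
    ≡⟨ ∑-sequences-cong m Bs (λ F |F|≡m →
         𝟙-⇔ (mk⇔ proj₁ (_, ≤-reflexive |F|≡m)) (optimallySeparating? F) (separating? F)) ⟩
  count separating? (sequences m Bs)
    ≡⟨ count-separating-bipartitions m k ⟩
  (2 ^ m ∸ 1) P′ k
    ≡⟨ P′≡!*C (∸-monoˡ-≤ 1 (n≤2^⌈log₂n⌉ (suc k))) ⟩
  k ! * ((2 ^ m ∸ 1) C k)
    ∎)
  where
  open ≡-Reasoning
  m = ⌈log₂ suc k ⌉
  Bs = bipartitions k
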